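{- Let $d\ge1$. If $m,n\ge d+1$ and $m+n\ge\binom{d+2}{2}$, then the complete bipartite graph $K_{m,n}$ admits a strong bipartite $d$-rigid partition.
   Context: Let $G=(A\cup B,E)$ be bipartite with bipartition $(A,B)$. For $X,Y\subseteq V$, $G[X,Y]$ is the graph on $X\cup Y$ with the edges of $G$ having one endpoint in $X$ and the other in $Y$. A partition $V_1,\dots,V_{d+1}$ of $V=A\cup B$ into nonempty sets, with $A_i=V_i\cap A$, $B_i=V_i\cap B$, is a strong bipartite $d$-rigid partition if $G[A_i,B_j]$ is connected for all $i\ne j$ (a graph with no vertices counts as disconnected), and there is a sequence $0\le s_1\le\dots\le s_{d+1}$ with $\sum_{i=1}^k s_i\ge\binom k2$ for all $1\le k\le d+1$ such that each $G[A_i,B_i]$ contains a forest with $s_i$ edges. -}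

module Defs where

open import Level using (0ℓ)
open import Data.Nat using (ℕ; zero; suc; _+_; _≤_)
open import Data.Nat.Combinatorics using (_C_)
open import Data.Fin using (Fin; toℕ) renaming (_≤_ to _≤ᶠ_)
open import Data.Sum using (_⊎_; inj₁; inj₂)
open import Data.Product using (_×_; _,_; ∃; ∃-syntax; Σ-syntax)
open import Data.Empty using (⊥)
open import Data.Unit using (⊤)
open import Data.List using (List; []; _∷_; _++_; length; map; take; allFin)
open import Data.Nat.ListAction using (sum)
open import Data.List.Membership.Propositional using (_∈_)
open import Data.List.Relation.Unary.Unique.Propositional using (Unique)
open import Data.List.Relation.Unary.Linked using (Linked)
open import Relation.Binary.PropositionalEquality using (_≡_; _≢_)
open import Relation.Nullary using (¬_)

BipGraph : ℕ → ℕ → Set₁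
BipGraph m n = Fin m → Fin n → Set

Vertex : ℕ → ℕ → Set
Vertex m n = Fin m ⊎ Fin n

Adj : ∀ {m n} → BipGraph m n → Vertex m n → Vertex m n → Set
Adj E (inj₁ a) (inj₂ b) = E a b
Adj E (inj₂ b) (inj₁ a) = E a b
Adj E (inj₁ _) (inj₁ _) = ⊥
Adj E (inj₂ _) (inj₂ _) = ⊥

data PathIn {m n} (E : BipGraph m n) (S : Vertex m n → Set) :
            Vertex m n → Vertex m n → Set where
  here  : ∀ {u} → PathIn E S u u
  there : ∀ {u w v} → Adj E u w → S w → PathIn E S w v → PathIn E S u v

-- The graph induced on vertex set S (with edges of E between them)
-- is connected: it has at least one vertex and every two vertices
-- are joined by a path inside S.  (The empty graph is disconnected.)
ConnectedOn : ∀ {m n} → BipGraph m n → (Vertex m n → Set) → Set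
ConnectedOn E S = (∃[ v ] S v) × (∀ u v → S u → S v → PathIn E S u v)

record Partition (d m n : ℕ) : Set where
  field
    pa : Fin m → Fin (suc d)
    pb : Fin n → Fin (suc d)

module _ {d m n : ℕ} (P : Partition d m n) where
  open Partition P

  AB : Fin (suc d) → Fin (suc d) → Vertex m n → Set
  AB i j (inj₁ a) = pa a ≡ i
  AB i j (inj₂ b) = pb b ≡ j

  Nonempty : Set
  Nonempty = ∀ i → (∃[ a ] pa a ≡ i) ⊎ (∃[ b ] pb b ≡ i)

EdgeList : ℕ → ℕ → Set
EdgeList m n = List (Fin m × Fin n)

asGraph : ∀ {m n} → EdgeList m n → BipGraph m n
asGraph F a b = (a , b) ∈ F

HasCycle : ∀ {m n} → BipGraph m n → Set
HasCycle {m} {n} E =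
  Σ[ v ∈ Vertex m n ] Σ[ vs ∈ List (Vertex m n) ]
    (3 ≤ length (v ∷ vs)) × Unique (v ∷ vs) × Linked (Adj E) (v ∷ vs ++ v ∷ [])

IsForest : ∀ {m n} → EdgeList m n → Set
IsForest F = ¬ HasCycle (asGraph F)

HasForestWithEdges : ∀ {d m n} → BipGraph m n → Partition d m n →
                     Fin (suc d) → ℕ → Set
HasForestWithEdges {m = m} {n} E P i s =
  Σ[ F ∈ EdgeList m n ]
    Unique F × length F ≡ s × IsForest F ×
    (∀ {a b} → (a , b) ∈ F → Partition.pa P a ≡ i × Partition.pb P b ≡ i × E a b)

partialSum : ∀ {d} → (Fin (suc d) → ℕ) → ℕ → ℕ
partialSum {d} s k = sum (map s (take k (allFin (suc d))))

Admissible : (d : ℕ) → (Fin (suc d) → ℕ) → Set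
Admissible d s =
  (∀ i j → i ≤ᶠ j → s i ≤ s j) ×
  (∀ k → 1 ≤ k → k ≤ suc d → k C 2 ≤ partialSum s k)

record StrongBipRigidPartition (d : ℕ) {m n : ℕ} (E : BipGraph m n) : Set where
  field
    part      : Partition d m n
    nonempty  : Nonempty part
    connected : ∀ i j → i ≢ j → ConnectedOn E (AB part i j)
    s         : Fin (suc d) → ℕ
    admissible : Admissible d s
    forests   : ∀ i → HasForestWithEdges E part i (s i)

K : (m n : ℕ) → BipGraph m n
K m n _ _ = ⊤

-- Choose hubs aᵢ ∈ A and bᵢ ∈ B in class Vᵢ for every i.  Then every Aᵢ and Bⱼ
-- is nonempty, so every G[Aᵢ,Bⱼ] of the complete graph is connected.  The
-- remaining m + n − 2(d+1) ≥ C(d+1,2) − (d+1) vertices are dealt out in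
-- consecutive blocks of sizes 0, 0, 1, 2, …, d−2 (the last class takes whatever
-- is left).  Joining every extra vertex of class i to the hub aᵢ or bᵢ on the
-- other side, together with the edge aᵢbᵢ, gives a double star in G[Aᵢ,Bᵢ]; its
-- edge counts s = (1, 1, 2, …, d−1, d−1) have partial sums C(k,2) + 1 for
-- 1 ≤ k ≤ d and C(d+1,2) for k = d+1 ≥ 3, so s is admissible.
module Submission where

open import Data.Empty using (⊥; ⊥-elim)
open import Data.Fin using (Fin; toℕ; zero; suc; _↑ˡ_; _↑ʳ_; splitAt; join; fromℕ<)
open import Data.Fin.Properties
  using (splitAt-↑ˡ; splitAt-↑ʳ; join-splitAt; toℕ-fromℕ<; toℕ-injective; toℕ<n; ↑ʳ-injective)
open import Data.List using ([]; _∷_; _++_; map; take; tabulate)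
open import Data.List.Properties using (length-tabulate)
open import Data.List.Membership.Propositional using (_∈_)
open import Data.List.Membership.Propositional.Properties using (∈-tabulate⁻)
open import Data.List.Relation.Unary.All as All using (All; _∷_)
import Data.List.Relation.Unary.All.Properties as All
open import Data.List.Relation.Unary.AllPairs using (_∷_)
open import Data.List.Relation.Unary.Any using (here; there)
open import Data.List.Relation.Unary.Linked using (Linked; _∷_)
open import Data.List.Relation.Unary.Unique.Propositional using (Unique)
import Data.List.Relation.Unary.Unique.Propositional.Properties as Unique
open import Data.Nat
open import Data.Nat.Combinatorics using (_C_; nCk+nC[k+1]≡[n+1]C[k+1]; nC1≡n)
open import Data.Nat.ListAction using (sum)
open import Data.Nat.Properties
open import Algebra.Properties.CommutativeSemigroup +-commutativeSemigroup
  using (interchange; x∙yz≈y∙xz)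
open import Data.Product using (_×_; _,_; proj₁; proj₂; ∃-syntax)
open import Data.Sum using (_⊎_; inj₁; inj₂; [_,_]′)
open import Data.Unit using (tt)
open import Defs
open import Function using (_∘_; id)
open import Relation.Binary.Core using (Rel)
open import Relation.Binary.PropositionalEquality
open import Relation.Nullary using (yes; no; contradiction)

module _ {a ℓ} {A : Set a} {R : Rel A ℓ} where

  linked-into-last : ∀ {z} y ys → Linked R (y ∷ ys ++ z ∷ []) → ∃[ l ] l ∈ y ∷ ys × R l z
  linked-into-last y []        (y~z ∷ _) = y , here refl , y~z
  linked-into-last y (y′ ∷ ys) (_ ∷ walk) with linked-into-last y′ ys walk
  ... | l , l∈ , l~z = l , there l∈ , l~z

  linked-step-avoiding : ∀ {c v w} rest → c ≢ v → All (c ≢_) rest →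
                         Linked R (w ∷ rest ++ v ∷ []) → ∃[ x ] R w x × c ≢ x
  linked-step-avoiding []       c≢v _         (w~v ∷ _) = _ , w~v , c≢v
  linked-step-avoiding (x ∷ _)  _   (c≢x ∷ _) (w~x ∷ _) = x , w~x , c≢x

Adj-sym : ∀ {m n} (E : BipGraph m n) x y → Adj E x y → Adj E y x
Adj-sym E (inj₁ _) (inj₂ _) e = e
Adj-sym E (inj₂ _) (inj₁ _) e = e

-- A cycle has three distinct vertices with two distinct neighbours each, but
-- only the two hubs of a double star can have two distinct neighbours.
module DoubleStar {m n} (F : EdgeList m n) (a₀ : Fin m) (b₀ : Fin n)
                  (touches-hub : ∀ {a b} → (a , b) ∈ F → a ≡ a₀ ⊎ b ≡ b₀) where

  Hub : Vertex m n → Set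
  Hub y = y ≡ inj₁ a₀ ⊎ y ≡ inj₂ b₀

  hub-if-two-neighbours : ∀ {y x z} → Adj (asGraph F) y x → Adj (asGraph F) y z → x ≢ z → Hub y
  hub-if-two-neighbours {inj₁ _} {inj₂ _} {inj₂ _} e e′ x≢z with touches-hub e | touches-hub e′
  ... | inj₁ refl | _         = inj₁ refl
  ... | inj₂ _    | inj₁ refl = inj₁ refl
  ... | inj₂ refl | inj₂ refl = ⊥-elim (x≢z refl)
  hub-if-two-neighbours {inj₂ _} {inj₁ _} {inj₁ _} e e′ x≢z with touches-hub e | touches-hub e′
  ... | inj₂ refl | _         = inj₂ refl
  ... | inj₁ _    | inj₂ refl = inj₂ refl
  ... | inj₁ refl | inj₁ refl = ⊥-elim (x≢z refl)

  no-three-hubs : ∀ {u v w} → Hub u → Hub v → Hub w → u ≢ v → u ≢ w → v ≢ w → ⊥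
  no-three-hubs (inj₁ refl) (inj₁ refl) _           u≢v _   _   = u≢v refl
  no-three-hubs (inj₂ refl) (inj₂ refl) _           u≢v _   _   = u≢v refl
  no-three-hubs (inj₁ refl) (inj₂ refl) (inj₁ refl) _   u≢w _   = u≢w refl
  no-three-hubs (inj₁ refl) (inj₂ refl) (inj₂ refl) _   _   v≢w = v≢w refl
  no-three-hubs (inj₂ refl) (inj₁ refl) (inj₁ refl) _   _   v≢w = v≢w refl
  no-three-hubs (inj₂ refl) (inj₁ refl) (inj₂ refl) _   u≢w _   = u≢w refl

  isForest : IsForest F
  isForest (_ , []     , s≤s () , _)
  isForest (_ , _ ∷ [] , s≤s (s≤s ()) , _)
  isForest (v , v₁ ∷ v₂ ∷ rest , _ , (v≢v₁ ∷ v≢v₂ ∷ _) ∷ (v₁≢v₂ ∷ v₁∉rest) ∷ _ , v~v₁ ∷ v₁~v₂ ∷ cycle) =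
    no-three-hubs v-hub v₁-hub v₂-hub v≢v₁ v≢v₂ v₁≢v₂
    where
    v₁-hub : Hub v₁
    v₁-hub = hub-if-two-neighbours (Adj-sym _ v v₁ v~v₁) v₁~v₂ v≢v₂

    v₂-hub : Hub v₂
    v₂-hub with linked-step-avoiding rest (≢-sym v≢v₁) v₁∉rest cycle
    ... | x , v₂~x , v₁≢x = hub-if-two-neighbours (Adj-sym _ v₁ v₂ v₁~v₂) v₂~x v₁≢x

    v-hub : Hub v
    v-hub with linked-into-last v₂ rest cycle
    ... | l , l∈ , l~v = hub-if-two-neighbours v~v₁ (Adj-sym _ l v l~v) (All.lookup (v₁≢v₂ ∷ v₁∉rest) l∈)

sumBelow : (ℕ → ℕ) → ℕ → ℕ
sumBelow f zero    = 0
sumBelow f (suc k) = f 0 + sumBelow (f ∘ suc) k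

sumBelow-suc : ∀ f k → sumBelow f (suc k) ≡ sumBelow f k + f k
sumBelow-suc f zero    = +-identityʳ (f 0)
sumBelow-suc f (suc k) = trans (cong (f 0 +_) (sumBelow-suc (f ∘ suc) k)) (sym (+-assoc (f 0) _ _))

sumBelow-mono-≤ : ∀ f {k l} → k ≤ l → sumBelow f k ≤ sumBelow f l
sumBelow-mono-≤ f {zero}          _         = z≤n
sumBelow-mono-≤ f {suc _} {suc _} (s≤s k≤l) = +-monoʳ-≤ (f 0) (sumBelow-mono-≤ (f ∘ suc) k≤l)

sumBelow-suc∘ : ∀ f k → sumBelow (suc ∘ f) k ≡ k + sumBelow f k
sumBelow-suc∘ f zero    = refl
sumBelow-suc∘ f (suc k) = cong suc (begin
  f 0 + sumBelow (suc ∘ f ∘ suc) k  ≡⟨ cong (f 0 +_) (sumBelow-suc∘ (f ∘ suc) k) ⟩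
  f 0 + (k + sumBelow (f ∘ suc) k)  ≡⟨ x∙yz≈y∙xz (f 0) k _ ⟩
  k + (f 0 + sumBelow (f ∘ suc) k)  ∎)
  where open ≡-Reasoning

sum-map-take-tabulate : ∀ {n p} (g : Fin p → ℕ) (h : Fin n → Fin p) (f : ℕ → ℕ) →
                        (∀ x → g (h x) ≡ f (toℕ x)) →
                        ∀ {k} → k ≤ n → sum (map g (take k (tabulate h))) ≡ sumBelow f k
sum-map-take-tabulate g h f g∘h≗f {zero}  _         = refl
sum-map-take-tabulate g h f g∘h≗f {suc k} (s≤s k≤n) =
  cong₂ _+_ (g∘h≗f zero) (sum-map-take-tabulate g (h ∘ suc) (f ∘ suc) (g∘h≗f ∘ suc) k≤n)

partialSum-sumBelow : ∀ {d} (f : ℕ → ℕ) {k} → k ≤ suc d → partialSum {d} (f ∘ toℕ) k ≡ sumBelow f k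
partialSum-sumBelow f = sum-map-take-tabulate (f ∘ toℕ) id f (λ _ → refl)

-- Consecutive blocks of lengths len 0, len 1, …, the last one unbounded

block : (k : ℕ) → (ℕ → ℕ) → ℕ → Fin (suc k)
block zero    len p = zero
block (suc k) len p with p <? len 0
... | yes _ = zero
... | no  _ = suc (block k (len ∘ suc) (p ∸ len 0))

block-sumBelow+ : ∀ k len (i : Fin (suc k)) {j} → j < len (toℕ i) →
                  block k len (sumBelow len (toℕ i) + j) ≡ i
block-sumBelow+ zero    len zero        _     = refl
block-sumBelow+ (suc k) len zero    {j} j<len with j <? len 0
... | yes _    = refl
... | no  j≮len = contradiction j<len j≮len
block-sumBelow+ (suc k) len (suc i) {j} j<len with len 0 + sumBelow (len ∘ suc) (toℕ i) + j <? len 0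
... | yes p<len = contradiction p<len (≤⇒≯ (≤-trans (m≤m+n (len 0) _) (m≤m+n _ j)))
... | no  _     = cong suc (trans (cong (block k (len ∘ suc)) skip-first) (block-sumBelow+ k (len ∘ suc) i j<len))
  where
  skip-first : len 0 + sumBelow (len ∘ suc) (toℕ i) + j ∸ len 0 ≡ sumBelow (len ∘ suc) (toℕ i) + j
  skip-first = trans (cong (_∸ len 0) (+-assoc (len 0) _ j)) (m+n∸m≡n (len 0) _)

-- The block lengths 0, 0, 1, 2, …, d−2

[n+1]C2≡nC2+n : ∀ n → suc n C 2 ≡ n C 2 + n
[n+1]C2≡nC2+n n = begin
  suc n C 2          ≡⟨ nCk+nC[k+1]≡[n+1]C[k+1] n 1 ⟨
  n C 1 + n C 2      ≡⟨ cong (_+ n C 2) (nC1≡n n) ⟩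
  n + n C 2          ≡⟨ +-comm n (n C 2) ⟩
  n C 2 + n          ∎
  where open ≡-Reasoning

extras : ℕ → ℕ → ℕ
extras d j = pred j ⊓ (d ∸ 2)

extras-mono : ∀ d {i j} → i ≤ j → extras d i ≤ extras d j
extras-mono d i≤j = ⊓-monoˡ-≤ (d ∸ 2) (pred-mono-≤ i≤j)

extras-suc : ∀ {d k} → suc k < d → extras d (suc k) ≡ k
extras-suc 2+k≤d = m≤n⇒m⊓n≡m (∸-monoˡ-≤ 2 2+k≤d)

sumBelow-extras : ∀ {d k} → k < d → sumBelow (extras d) (suc k) + k ≡ suc k C 2
sumBelow-extras {d} {zero}  _     = refl
sumBelow-extras {d} {suc k} 1+k<d = begin
  sumBelow (extras d) (suc (suc k)) + suc k  ≡⟨ cong (_+ suc k) (sumBelow-suc (extras d) (suc k)) ⟩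
  S + extras d (suc k) + suc k               ≡⟨ cong (λ x → S + x + suc k) (extras-suc 1+k<d) ⟩
  S + k + suc k                              ≡⟨ cong (_+ suc k) (sumBelow-extras (<-trans (n<1+n k) 1+k<d)) ⟩
  suc k C 2 + suc k                          ≡⟨ [n+1]C2≡nC2+n (suc k) ⟨
  suc (suc k) C 2                            ∎
  where
  S = sumBelow (extras d) (suc k)
  open ≡-Reasoning

sumBelow-extras-all : ∀ {d} → 2 ≤ d → sumBelow (extras d) (suc d) + suc d ≡ suc d C 2
sumBelow-extras-all {d@(suc (suc k))} (s≤s (s≤s z≤n)) = begin
  sumBelow (extras d) (suc d) + suc d  ≡⟨ cong (_+ suc d) (sumBelow-suc (extras d) d) ⟩
  S + extras d d + suc d               ≡⟨ cong (λ x → S + x + suc d) (m≥n⇒m⊓n≡n (n≤1+n k)) ⟩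
  S + k + suc d                        ≡⟨ +-suc (S + k) d ⟩
  suc (S + k + d)                      ≡⟨ cong (_+ d) (+-suc S k) ⟨
  S + suc k + d                        ≡⟨ cong (_+ d) (sumBelow-extras (n<1+n (suc k))) ⟩
  d C 2 + d                            ≡⟨ [n+1]C2≡nC2+n d ⟨
  suc d C 2                            ∎
  where
  S = sumBelow (extras d) d
  open ≡-Reasoning

[d+1]C2≤d+1+sumBelow-extras : ∀ {d} → 1 ≤ d → suc d C 2 ≤ suc d + sumBelow (extras d) (suc d)
[d+1]C2≤d+1+sumBelow-extras {suc zero}    _ = s≤s z≤n
[d+1]C2≤d+1+sumBelow-extras {d@(suc (suc _))} _ =
  ≤-reflexive (trans (sym (sumBelow-extras-all {d} (s≤s (s≤s z≤n)))) (+-comm (sumBelow (extras d) (suc d)) (suc d)))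

kC2≤k+sumBelow-extras : ∀ {d k} → 1 ≤ d → 1 ≤ k → k ≤ suc d → k C 2 ≤ k + sumBelow (extras d) k
kC2≤k+sumBelow-extras {d} {suc k} 1≤d _ 1+k≤1+d with m≤n⇒m<n∨m≡n (s≤s⁻¹ 1+k≤1+d)
... | inj₂ refl = [d+1]C2≤d+1+sumBelow-extras 1≤d
... | inj₁ k<d  = begin
  suc k C 2   ≡⟨ sumBelow-extras k<d ⟨
  S + k       ≡⟨ +-comm S k ⟩
  k + S       ≤⟨ n≤1+n (k + S) ⟩
  suc k + S   ∎
  where
  S = sumBelow (extras d) (suc k)
  open ≤-Reasoning

extras-admissible : ∀ d → 1 ≤ d → Admissible d (suc ∘ extras d ∘ toℕ)
extras-admissible d 1≤d = (λ _ _ i≤j → s≤s (extras-mono d i≤j)) , partialSums≥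
  where
  partialSums≥ : ∀ k → 1 ≤ k → k ≤ suc d → k C 2 ≤ partialSum (suc ∘ extras d ∘ toℕ) k
  partialSums≥ k 1≤k k≤1+d = begin
    k C 2                                  ≤⟨ kC2≤k+sumBelow-extras 1≤d 1≤k k≤1+d ⟩
    k + sumBelow (extras d) k              ≡⟨ sumBelow-suc∘ (extras d) k ⟨
    sumBelow (suc ∘ extras d) k            ≡⟨ partialSum-sumBelow (suc ∘ extras d) k≤1+d ⟨
    partialSum (suc ∘ extras d ∘ toℕ) k    ∎
    where open ≤-Reasoning

sumBelow-extras≤ : ∀ d M N → 1 ≤ d → suc (suc d) C 2 ≤ (suc d + M) + (suc d + N) →
                   sumBelow (extras d) (suc d) ≤ M + N
sumBelow-extras≤ (suc zero)         M N _ _   = z≤n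
sumBelow-extras≤ d@(suc (suc _)) M N _ hyp = +-cancelʳ-≤ (suc d + suc d) S (M + N) (begin
  S + (suc d + suc d)          ≡⟨ +-assoc S (suc d) (suc d) ⟨
  S + suc d + suc d            ≡⟨ cong (_+ suc d) (sumBelow-extras-all (s≤s (s≤s z≤n))) ⟩
  suc d C 2 + suc d            ≡⟨ [n+1]C2≡nC2+n (suc d) ⟨
  suc (suc d) C 2              ≤⟨ hyp ⟩
  (suc d + M) + (suc d + N)    ≡⟨ interchange (suc d) M (suc d) N ⟩
  (suc d + suc d) + (M + N)    ≡⟨ +-comm (suc d + suc d) (M + N) ⟩
  (M + N) + (suc d + suc d)    ∎)
  where
  S = sumBelow (extras d) (suc d)
  open ≤-Reasoning

↑ˡ≢↑ʳ : ∀ {m n} (i : Fin m) (j : Fin n) → i ↑ˡ n ≢ m ↑ʳ j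
↑ˡ≢↑ʳ {m} {n} i j eq with trans (sym (splitAt-↑ˡ m i n)) (trans (cong (splitAt m) eq) (splitAt-↑ʳ m n j))
... | ()

splitAt-injective : ∀ m {n} {x y : Fin (m + n)} → splitAt m x ≡ splitAt m y → x ≡ y
splitAt-injective m {n} {x} {y} eq =
  trans (sym (join-splitAt m n x)) (trans (cong (join m n) eq) (join-splitAt m n y))

K-connectedOn : ∀ {m n} (S : Vertex m n → Set) →
                ∃[ a ] S (inj₁ a) → ∃[ b ] S (inj₂ b) → ConnectedOn (K m n) S
K-connectedOn {m} {n} S (a , Sa) (b , Sb) = (inj₁ a , Sa) , path
  where
  path : ∀ u v → S u → S v → PathIn (K m n) S u v
  path (inj₁ _) (inj₂ _) _ Sv = there tt Sv here
  path (inj₂ _) (inj₁ _) _ Sv = there tt Sv here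
  path (inj₁ _) (inj₁ _) _ Sv = there {w = inj₂ b} tt Sb (there tt Sv here)
  path (inj₂ _) (inj₂ _) _ Sv = there {w = inj₁ a} tt Sa (there tt Sv here)

-- The hubs aᵢ, bᵢ are the first d+1 vertices of each side; the M + N extra
-- vertices are numbered A-side first and cut into blocks of lengths len i.
module DoubleStarPartition (d M N : ℕ) (len : ℕ → ℕ) (budget : sumBelow len (suc d) ≤ M + N) where

  m n : ℕ
  m = suc d + M
  n = suc d + N

  hubA : Fin (suc d) → Fin m
  hubA i = i ↑ˡ M

  hubB : Fin (suc d) → Fin n
  hubB i = i ↑ˡ N

  extraClass : Fin (M + N) → Fin (suc d)
  extraClass x = block d len (toℕ x)

  part : Partition d m n
  part = record
    { pa = [ id , (λ q → extraClass (q ↑ˡ N)) ]′ ∘ splitAt (suc d)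
    ; pb = [ id , (λ r → extraClass (M ↑ʳ r)) ]′ ∘ splitAt (suc d)
    }

  open Partition part

  pa-hubA : ∀ i → pa (hubA i) ≡ i
  pa-hubA i rewrite splitAt-↑ˡ (suc d) i M = refl

  pb-hubB : ∀ i → pb (hubB i) ≡ i
  pb-hubB i rewrite splitAt-↑ˡ (suc d) i N = refl

  spoke : Fin (suc d) → Fin M ⊎ Fin N → Fin m × Fin n
  spoke i (inj₁ q) = suc d ↑ʳ q , hubB i
  spoke i (inj₂ r) = hubA i , suc d ↑ʳ r

  spoke-touches-hub : ∀ i y → proj₁ (spoke i y) ≡ hubA i ⊎ proj₂ (spoke i y) ≡ hubB i
  spoke-touches-hub i (inj₁ _) = inj₂ refl
  spoke-touches-hub i (inj₂ _) = inj₁ refl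

  spoke-inClass : ∀ i y → extraClass (join M N y) ≡ i →
                  pa (proj₁ (spoke i y)) ≡ i × pb (proj₂ (spoke i y)) ≡ i
  spoke-inClass i (inj₁ q) q∈i rewrite splitAt-↑ʳ (suc d) M q = q∈i , pb-hubB i
  spoke-inClass i (inj₂ r) r∈i rewrite splitAt-↑ʳ (suc d) N r = pa-hubA i , r∈i

  hubEdge≢spoke : ∀ i y → (hubA i , hubB i) ≢ spoke i y
  hubEdge≢spoke i (inj₁ q) eq = ↑ˡ≢↑ʳ i q (cong proj₁ eq)
  hubEdge≢spoke i (inj₂ r) eq = ↑ˡ≢↑ʳ i r (cong proj₂ eq)

  spoke-injective : ∀ i {y y′} → spoke i y ≡ spoke i y′ → y ≡ y′
  spoke-injective i {inj₁ q} {inj₁ q′} eq = cong inj₁ (↑ʳ-injective (suc d) q q′ (cong proj₁ eq))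
  spoke-injective i {inj₁ q} {inj₂ _}  eq = ⊥-elim (↑ˡ≢↑ʳ i q (sym (cong proj₁ eq)))
  spoke-injective i {inj₂ _} {inj₁ q}  eq = ⊥-elim (↑ˡ≢↑ʳ i q (cong proj₁ eq))
  spoke-injective i {inj₂ r} {inj₂ r′} eq = cong inj₂ (↑ʳ-injective (suc d) r r′ (cong proj₂ eq))

  slot<M+N : ∀ (i : Fin (suc d)) (j : Fin (len (toℕ i))) → sumBelow len (toℕ i) + toℕ j < M + N
  slot<M+N i j = begin-strict
    sumBelow len (toℕ i) + toℕ j         <⟨ +-monoʳ-< (sumBelow len (toℕ i)) (toℕ<n j) ⟩
    sumBelow len (toℕ i) + len (toℕ i)   ≡⟨ sumBelow-suc len (toℕ i) ⟨
    sumBelow len (suc (toℕ i))           ≤⟨ sumBelow-mono-≤ len (toℕ<n i) ⟩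
    sumBelow len (suc d)                 ≤⟨ budget ⟩
    M + N                                ∎
    where open ≤-Reasoning

  slot : ∀ (i : Fin (suc d)) → Fin (len (toℕ i)) → Fin (M + N)
  slot i j = fromℕ< (slot<M+N i j)

  extraClass-slot : ∀ i j → extraClass (slot i j) ≡ i
  extraClass-slot i j =
    trans (cong (block d len) (toℕ-fromℕ< (slot<M+N i j))) (block-sumBelow+ d len i (toℕ<n j))

  slot-injective : ∀ i {j j′} → slot i j ≡ slot i j′ → j ≡ j′
  slot-injective i {j} {j′} eq = toℕ-injective (+-cancelˡ-≡ (sumBelow len (toℕ i)) _ _
    (trans (sym (toℕ-fromℕ< (slot<M+N i j))) (trans (cong toℕ eq) (toℕ-fromℕ< (slot<M+N i j′)))))

  spokes : ∀ (i : Fin (suc d)) → Fin (len (toℕ i)) → Fin m × Fin n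
  spokes i = spoke i ∘ splitAt M ∘ slot i

  doubleStar : Fin (suc d) → EdgeList m n
  doubleStar i = (hubA i , hubB i) ∷ tabulate (spokes i)

  doubleStar-unique : ∀ i → Unique (doubleStar i)
  doubleStar-unique i =
    All.tabulate⁺ (λ j → hubEdge≢spoke i (splitAt M (slot i j)))
    ∷ Unique.tabulate⁺ (λ eq → slot-injective i (splitAt-injective M (spoke-injective i eq)))

  doubleStar-touches-hub : ∀ i {a b} → (a , b) ∈ doubleStar i → a ≡ hubA i ⊎ b ≡ hubB i
  doubleStar-touches-hub i (here refl) = inj₁ refl
  doubleStar-touches-hub i (there e∈) with ∈-tabulate⁻ e∈
  ... | j , refl = spoke-touches-hub i (splitAt M (slot i j))

  spokes-inClass : ∀ i j → pa (proj₁ (spokes i j)) ≡ i × pb (proj₂ (spokes i j)) ≡ i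
  spokes-inClass i j = spoke-inClass i (splitAt M (slot i j))
    (trans (cong extraClass (join-splitAt M N (slot i j))) (extraClass-slot i j))

  doubleStar-inClass : ∀ i {a b} → (a , b) ∈ doubleStar i → pa a ≡ i × pb b ≡ i × K m n a b
  doubleStar-inClass i (here refl) = pa-hubA i , pb-hubB i , tt
  doubleStar-inClass i (there e∈) with ∈-tabulate⁻ e∈
  ... | j , refl = proj₁ (spokes-inClass i j) , proj₂ (spokes-inClass i j) , tt

  forest : ∀ i → HasForestWithEdges (K m n) part i (suc (len (toℕ i)))
  forest i = doubleStar i , doubleStar-unique i , cong suc (length-tabulate (spokes i))
           , DoubleStar.isForest (doubleStar i) (hubA i) (hubB i) (doubleStar-touches-hub i)
           , doubleStar-inClass i

  strongBipRigidPartition : Admissible d (suc ∘ len ∘ toℕ) → StrongBipRigidPartition d (K m n)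
  strongBipRigidPartition admissible = record
    { part       = part
    ; nonempty   = λ i → inj₁ (hubA i , pa-hubA i)
    ; connected  = λ i j _ → K-connectedOn (AB part i j) (hubA i , pa-hubA i) (hubB j , pb-hubB j)
    ; s          = suc ∘ len ∘ toℕ
    ; admissible = admissible
    ; forests    = forest
    }

proposition1p6 : ∀ (d m n : ℕ) → 1 ≤ d → suc d ≤ m → suc d ≤ n →
    (suc (suc d)) C 2 ≤ m + n → StrongBipRigidPartition d (K m n)
proposition1p6 d m n 1≤d d<m d<n C≤m+n with m≤n⇒∃[o]m+o≡n d<m | m≤n⇒∃[o]m+o≡n d<n
... | M , refl | N , refl =
  DoubleStarPartition.strongBipRigidPartition d M N (extras d)
    (sumBelow-extras≤ d M N 1≤d C≤m+n) (extras-admissible d 1≤d)
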